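{- Let $n\ge3$ be odd. Then $T^{gfb}_n$ and $T^{gfb}_{n-1}$ have a common maximal pending subtree, and $T^{gfb}_n$ and $T^{gfb}_{n+1}$ have a common maximal pending subtree (up to isomorphism).
   Context: A rooted binary tree with $n\ge2$ leaves is a rooted tree in which the root has degree 2 and every other internal vertex has degree 3 (each internal vertex has exactly two children); the single vertex is the rooted binary tree with one leaf. The maximal pending subtrees of a tree with at least two leaves are the two subtrees rooted at the children of the root. The GFB tree $T^{gfb}_n$ is the output (up to isomorphism) of the algorithm: start with $n$ single-vertex trees; while more than one tree remains, remove a tree $u$ with minimum number of leaves, then a tree $v$ with minimum number of leaves among the remaining, and add the tree with a new root whose children are the roots of $u$ and $v$; output the remaining tree. -}

module Defs where

open import Data.Nat using (ℕ; zero; suc; _+_; _≤_)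
open import Data.List using (List; []; _∷_; replicate)
open import Data.List.Relation.Unary.All using (All)
open import Data.List.Relation.Binary.Permutation.Propositional using (_↭_)
open import Data.List.Membership.Propositional using (_∈_)
open import Data.Product using (Σ; _×_; ∃)
open import Data.Sum using (_⊎_)

-- Rooted binary trees (shape only). A `node` has exactly two children;
-- the child order is NOT significant: it is quotiented out by `_≅_` below.
data Tree : Set where
  leaf : Tree
  node : Tree → Tree → Tree

leaves : Tree → ℕ
leaves leaf       = 1
leaves (node a b) = leaves a + leaves b

data _≅_ : Tree → Tree → Set where
  leaf≅  : leaf ≅ leaf
  node≅  : ∀ {a b c d} → a ≅ c → b ≅ d → node a b ≅ node c d
  swap≅  : ∀ {a b c d} → a ≅ d → b ≅ c → node a b ≅ node c d

pending : Tree → List Tree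
pending leaf       = []
pending (node a b) = a ∷ b ∷ []

CommonPending : Tree → Tree → Set
CommonPending T T' =
  Σ Tree λ x → Σ Tree λ y → x ∈ pending T × y ∈ pending T' × x ≅ y

-- GFBRun F T : T is a possible output of the GFB algorithm started from the
-- forest (multiset, represented as a list up to permutation) F, for any
-- admissible choice of u and v at each step.
data GFBRun : List Tree → Tree → Set where
  done : ∀ t → GFBRun (t ∷ []) t
  step : ∀ {F rest out} (u v : Tree) →
         F ↭ (u ∷ v ∷ rest) →
         All (λ w → leaves u ≤ leaves w) (v ∷ rest) →
         All (λ w → leaves v ≤ leaves w) rest →
         GFBRun (node u v ∷ rest) out →
         GFBRun F out

IsGFB : ℕ → Tree → Set
IsGFB n T = GFBRun (replicate n leaf) T

-- Let gfbTree j r (r ≤ 2 ^ j) be the perfect tree of height j with its r rightmost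
-- leaves split into cherries. During the GFB algorithm the forest always consists of
-- trees gfbTree j r for one common j, at most one of which has strictly between 2 ^ j
-- and 2 ^ (j + 1) leaves; merging the two smallest trees preserves this (raising j
-- once the perfect trees of height j are used up), so every run of the algorithm on
-- 2 ^ j + r leaves outputs exactly gfbTree j r, however ties are broken. For odd
-- n = 2 ^ j + r we have 0 < r < 2 ^ j, and gfbTree j r shares with gfbTree j (r ± 1)
-- either its untouched left half or its fully split right half.
module Submission where

open import Defs
open import Data.Nat using (ℕ; zero; suc; _+_; _*_; _∸_; _^_; _≤_; _<_; z≤n; s≤s; _≤?_)
open import Data.Nat.Properties
open import Data.Nat.Logarithm using (⌊log₂_⌋; ⌊log₂[2^n]⌋≡n)
open import Data.Nat.ListAction using (sum)
open import Data.Nat.ListAction.Properties using (sum-↭)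
open import Data.List using (List; []; _∷_; replicate; map)
open import Data.List.Relation.Unary.All as All using (All; []; _∷_)
open import Data.List.Relation.Unary.All.Properties using (replicate⁺)
open import Data.List.Relation.Unary.Any using (here; there)
open import Data.List.Relation.Binary.Permutation.Propositional as ↭ using (_↭_)
open import Data.List.Relation.Binary.Permutation.Propositional.Properties using (All-resp-↭; map⁺)
open import Data.Product using (_×_; ∃; ∃₂; _,_; uncurry)
open import Relation.Binary using (tri<; tri≈; tri>)
open import Relation.Binary.PropositionalEquality
  using (_≡_; refl; sym; trans; cong; cong₂; subst; subst₂; module ≡-Reasoning)
open import Relation.Nullary using (¬_; yes; no; contradiction)
open import Relation.Unary using (∁)

≅-refl : ∀ {t} → t ≅ t
≅-refl {leaf}     = leaf≅
≅-refl {node a b} = node≅ ≅-refl ≅-refl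

≅-reflexive : ∀ {s t} → s ≡ t → s ≅ t
≅-reflexive refl = ≅-refl

≅-sym : ∀ {s t} → s ≅ t → t ≅ s
≅-sym leaf≅       = leaf≅
≅-sym (node≅ p q) = node≅ (≅-sym p) (≅-sym q)
≅-sym (swap≅ p q) = swap≅ (≅-sym q) (≅-sym p)

CommonPending-sym : ∀ {T T′} → CommonPending T T′ → CommonPending T′ T
CommonPending-sym (x , y , x∈ , y∈ , x≅y) = y , x , y∈ , x∈ , ≅-sym x≅y

common-left : ∀ {a b c d} → a ≅ c → CommonPending (node a b) (node c d)
common-left a≅c = _ , _ , here refl , here refl , a≅c

common-right : ∀ {a b c d} → b ≅ d → CommonPending (node a b) (node c d)
common-right b≅d = _ , _ , there (here refl) , there (here refl) , b≅d

2^[1+i]≡2^i+2^i : ∀ i → 2 ^ suc i ≡ 2 ^ i + 2 ^ i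
2^[1+i]≡2^i+2^i i = cong (2 ^ i +_) (+-identityʳ (2 ^ i))

perfect : ℕ → Tree
perfect zero    = leaf
perfect (suc i) = node (perfect i) (perfect i)

-- Only meaningful for r ≤ 2 ^ j.
gfbTree : ℕ → ℕ → Tree
gfbTree zero    zero    = leaf
gfbTree zero    (suc _) = node leaf leaf
gfbTree (suc i) r with r ≤? 2 ^ i
... | yes _ = node (perfect i) (gfbTree i r)
... | no  _ = node (gfbTree i (r ∸ 2 ^ i)) (perfect (suc i))

gfbTree-lower : ∀ i {r} → r ≤ 2 ^ i → gfbTree (suc i) r ≡ node (perfect i) (gfbTree i r)
gfbTree-lower i {r} r≤2^i with r ≤? 2 ^ i
... | yes _   = refl
... | no  r≰ = contradiction r≤2^i r≰

gfbTree-upper : ∀ i {r} → 0 < r →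
                gfbTree (suc i) (2 ^ i + r) ≡ node (gfbTree i r) (perfect (suc i))
gfbTree-upper i {r} 0<r with 2 ^ i + r ≤? 2 ^ i
... | yes ≤2^i = contradiction ≤2^i (<⇒≱ (m<m+n (2 ^ i) 0<r))
... | no  _    = cong (λ s → node (gfbTree i s) (perfect (suc i))) (m+n∸m≡n (2 ^ i) r)

gfbTree-zero : ∀ i → gfbTree i 0 ≡ perfect i
gfbTree-zero zero    = refl
gfbTree-zero (suc i) = trans (gfbTree-lower i z≤n) (cong (node (perfect i)) (gfbTree-zero i))

gfbTree-full : ∀ i → gfbTree i (2 ^ i) ≡ perfect (suc i)
gfbTree-full zero    = refl
gfbTree-full (suc i) rewrite 2^[1+i]≡2^i+2^i i =
  trans (gfbTree-upper i (m^n>0 2 i)) (cong (λ t → node t (perfect (suc i))) (gfbTree-full i))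

leaves-perfect : ∀ i → leaves (perfect i) ≡ 2 ^ i
leaves-perfect zero    = refl
leaves-perfect (suc i) =
  trans (cong₂ _+_ (leaves-perfect i) (leaves-perfect i)) (sym (2^[1+i]≡2^i+2^i i))

leaves-gfbTree : ∀ i {r} → r ≤ 2 ^ i → leaves (gfbTree i r) ≡ 2 ^ i + r
leaves-gfbTree zero    z≤n       = refl
leaves-gfbTree zero    (s≤s z≤n) = refl
leaves-gfbTree (suc i) {r} r≤2^[1+i] with r ≤? 2 ^ i
... | yes r≤2^i = begin
  leaves (perfect i) + leaves (gfbTree i r)
    ≡⟨ cong₂ _+_ (leaves-perfect i) (leaves-gfbTree i r≤2^i) ⟩
  2 ^ i + (2 ^ i + r)                        ≡⟨ sym (+-assoc (2 ^ i) (2 ^ i) r) ⟩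
  (2 ^ i + 2 ^ i) + r                        ≡⟨ cong (_+ r) (sym (2^[1+i]≡2^i+2^i i)) ⟩
  2 ^ suc i + r                              ∎
  where open ≡-Reasoning
... | no  r≰2^i = begin
  leaves (gfbTree i (r ∸ 2 ^ i)) + leaves (perfect (suc i))
    ≡⟨ cong₂ _+_ (leaves-gfbTree i (m≤n+o⇒m∸n≤o r (2 ^ i) r≤2^i+2^i)) (leaves-perfect (suc i)) ⟩
  (2 ^ i + (r ∸ 2 ^ i)) + 2 ^ suc i ≡⟨ cong (_+ 2 ^ suc i) (m+[n∸m]≡n (<⇒≤ (≰⇒> r≰2^i))) ⟩
  r + 2 ^ suc i                     ≡⟨ +-comm r (2 ^ suc i) ⟩
  2 ^ suc i + r                     ∎
  where
  open ≡-Reasoning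
  r≤2^i+2^i : r ≤ 2 ^ i + 2 ^ i
  r≤2^i+2^i = subst (r ≤_) (2^[1+i]≡2^i+2^i i) r≤2^[1+i]

-- The only overlap between the representations 2 ^ j + r: 2 ^ j + 2 ^ j = 2 ^ (j + 1) + 0.
gfbTree-carry : ∀ {j k r r′} → j < k → 2 ^ j + r ≡ 2 ^ k + r′ → r ≤ 2 ^ j →
                gfbTree j r ≡ gfbTree k r′
gfbTree-carry {j} {k} {r} {r′} j<k e r≤2^j = begin
  gfbTree j r           ≡⟨ cong (gfbTree j) r≡2^j ⟩
  gfbTree j (2 ^ j)     ≡⟨ gfbTree-full j ⟩
  perfect (suc j)       ≡⟨ sym (gfbTree-zero (suc j)) ⟩
  gfbTree (suc j) 0     ≡⟨ cong₂ gfbTree (sym k≡1+j) (sym r′≡0) ⟩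
  gfbTree k r′          ∎
  where
  open ≡-Reasoning
  total≤ : 2 ^ k + r′ ≤ 2 ^ suc j
  total≤ = subst₂ _≤_ e (sym (2^[1+i]≡2^i+2^i j)) (+-monoʳ-≤ (2 ^ j) r≤2^j)
  2^k≡2^[1+j] : 2 ^ k ≡ 2 ^ suc j
  2^k≡2^[1+j] = ≤-antisym (≤-trans (m≤m+n (2 ^ k) r′) total≤) (^-monoʳ-≤ 2 j<k)
  k≡1+j : k ≡ suc j
  k≡1+j = trans (sym (⌊log₂[2^n]⌋≡n k))
                (trans (cong ⌊log₂_⌋ 2^k≡2^[1+j]) (⌊log₂[2^n]⌋≡n (suc j)))
  r′≡0 : r′ ≡ 0
  r′≡0 = n≤0⇒n≡0 (+-cancelˡ-≤ (2 ^ k) r′ 0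
           (subst (2 ^ k + r′ ≤_) (trans (sym 2^k≡2^[1+j]) (sym (+-identityʳ (2 ^ k)))) total≤))
  r≡2^j : r ≡ 2 ^ j
  r≡2^j = +-cancelˡ-≡ (2 ^ j) r (2 ^ j) (begin
    2 ^ j + r         ≡⟨ e ⟩
    2 ^ k + r′        ≡⟨ cong₂ _+_ 2^k≡2^[1+j] r′≡0 ⟩
    2 ^ suc j + 0     ≡⟨ +-identityʳ (2 ^ suc j) ⟩
    2 ^ suc j         ≡⟨ 2^[1+i]≡2^i+2^i j ⟩
    2 ^ j + 2 ^ j     ∎)

gfbTree-determined : ∀ {j k r r′} → 2 ^ j + r ≡ 2 ^ k + r′ → r ≤ 2 ^ j → r′ ≤ 2 ^ k →
                     gfbTree j r ≡ gfbTree k r′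
gfbTree-determined {j} {k} e r≤ r′≤ with <-cmp j k
... | tri< j<k _ _ = gfbTree-carry j<k e r≤
... | tri> _ _ k<j = sym (gfbTree-carry k<j (sym e) r′≤)
... | tri≈ _ refl _ = cong (gfbTree j) (+-cancelˡ-≡ (2 ^ j) _ _ e)

gfbTree-adjacent : ∀ i s → CommonPending (gfbTree (suc i) (suc s)) (gfbTree (suc i) s)
gfbTree-adjacent i s with suc s ≤? 2 ^ i | s ≤? 2 ^ i
... | yes _   | yes _   = common-left ≅-refl
... | yes s<  | no  s≰ = contradiction (<⇒≤ s<) s≰
... | no  _   | no  _   = common-right ≅-refl
... | no  s≮ | yes s≤ =
  common-right (≅-reflexive (sym (trans (cong (gfbTree i) s≡2^i) (gfbTree-full i))))
  where
  s≡2^i : s ≡ 2 ^ i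
  s≡2^i = ≤-antisym s≤ (≮⇒≥ (λ s<2^i → s≮ s<2^i))

data AtMostOne {A : Set} (P : A → Set) : List A → Set where
  []    : AtMostOne P []
  here  : ∀ {x xs} → All (∁ P) xs → AtMostOne P (x ∷ xs)
  there : ∀ {x xs} → ¬ P x → AtMostOne P xs → AtMostOne P (x ∷ xs)

module _ {A : Set} {P : A → Set} where

  All∁⇒AtMostOne : ∀ {xs} → All (∁ P) xs → AtMostOne P xs
  All∁⇒AtMostOne []          = []
  All∁⇒AtMostOne (¬px ∷ pxs) = there ¬px (All∁⇒AtMostOne pxs)

  AtMostOne-tail : ∀ {x xs} → AtMostOne P (x ∷ xs) → AtMostOne P xs
  AtMostOne-tail (here ¬pxs)  = All∁⇒AtMostOne ¬pxs
  AtMostOne-tail (there _ as) = as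

  AtMostOne-resp-↭ : ∀ {xs ys} → xs ↭ ys → AtMostOne P xs → AtMostOne P ys
  AtMostOne-resp-↭ ↭.refl         as = as
  AtMostOne-resp-↭ (↭.prep x p)   (here ¬pxs) = here (All-resp-↭ p ¬pxs)
  AtMostOne-resp-↭ (↭.prep x p)   (there ¬px as) = there ¬px (AtMostOne-resp-↭ p as)
  AtMostOne-resp-↭ (↭.swap x y p) (here (¬py ∷ ¬pxs)) = there ¬py (here (All-resp-↭ p ¬pxs))
  AtMostOne-resp-↭ (↭.swap x y p) (there ¬px (here ¬pxs)) = here (¬px ∷ All-resp-↭ p ¬pxs)
  AtMostOne-resp-↭ (↭.swap x y p) (there ¬px (there ¬py as)) =
    there ¬py (there ¬px (AtMostOne-resp-↭ p as))
  AtMostOne-resp-↭ (↭.trans p q)  as = AtMostOne-resp-↭ q (AtMostOne-resp-↭ p as)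

data Level (j : ℕ) : Tree → Set where
  level : ∀ {r} → r ≤ 2 ^ j → Level j (gfbTree j r)

record Mid (j : ℕ) (t : Tree) : Set where
  constructor mid
  field
    above : 2 ^ j < leaves t
    below : leaves t < 2 ^ suc j

GFBForest : ℕ → List Tree → Set
GFBForest j F = All (Level j) F × AtMostOne (Mid j) F

perfect-level : ∀ j → Level j (perfect j)
perfect-level j = subst (Level j) (gfbTree-zero j) (level z≤n)

perfect-¬Mid : ∀ j → ¬ Mid j (perfect j)
perfect-¬Mid j (mid above _) = <-irrefl (sym (leaves-perfect j)) above

perfect-suc-¬Mid : ∀ j → ¬ Mid j (perfect (suc j))
perfect-suc-¬Mid j (mid _ below) = <-irrefl (leaves-perfect (suc j)) below

¬Mid-above⇒≥2^[1+j] : ∀ {j t} → ¬ Mid j t → 2 ^ j < leaves t → 2 ^ suc j ≤ leaves t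
¬Mid-above⇒≥2^[1+j] ¬mid above = ≮⇒≥ (λ below → ¬mid (mid above below))

above-head⇒rest-≥2^[1+j] : ∀ {j x G} → AtMostOne (Mid j) (x ∷ G) → 2 ^ j < leaves x →
                            All (λ w → leaves x ≤ leaves w) G → All (λ w → 2 ^ suc j ≤ leaves w) G
above-head⇒rest-≥2^[1+j] (here ¬mids) above x≤G =
  All.zipWith (λ (¬mid , x≤w) → ¬Mid-above⇒≥2^[1+j] ¬mid (<-≤-trans above x≤w)) (¬mids , x≤G)
above-head⇒rest-≥2^[1+j] (there ¬mid _) above x≤G =
  All.map (≤-trans (¬Mid-above⇒≥2^[1+j] ¬mid above)) x≤G

Level-full⇒perfect : ∀ {j t} → Level j t → 2 ^ suc j ≤ leaves t → t ≡ perfect (suc j)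
Level-full⇒perfect {j} (level {r} r≤2^j) full = trans (cong (gfbTree j) r≡2^j) (gfbTree-full j)
  where
  r≡2^j : r ≡ 2 ^ j
  r≡2^j = ≤-antisym r≤2^j (+-cancelˡ-≤ (2 ^ j) (2 ^ j) r
            (subst₂ _≤_ (2^[1+i]≡2^i+2^i j) (leaves-gfbTree j r≤2^j) full))

promote : ∀ {j t rest} → Level (suc j) t → All (_≡ perfect (suc j)) rest →
          GFBForest (suc j) (t ∷ rest)
promote {j} t-level perfects =
    (t-level ∷ All.map (λ { refl → perfect-level (suc j) }) perfects)
  , here (All.map (λ { refl → perfect-¬Mid (suc j) }) perfects)

2^j<leaves-gfbTree : ∀ j {r} → 0 < r → r ≤ 2 ^ j → 2 ^ j < leaves (gfbTree j r)
2^j<leaves-gfbTree j 0<r r≤2^j = subst (2 ^ j <_) (sym (leaves-gfbTree j r≤2^j)) (m<m+n (2 ^ j) 0<r)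

merge : ∀ {j u v rest} → GFBForest j (u ∷ v ∷ rest) →
        All (λ w → leaves u ≤ leaves w) (v ∷ rest) → All (λ w → leaves v ≤ leaves w) rest →
        ∃ λ j′ → GFBForest j′ (node u v ∷ rest)
merge {j} (level {zero} _ ∷ level {zero} _ ∷ levels , mids) _ _ rewrite gfbTree-zero j =
    j
  , (subst (Level j) (gfbTree-full j) (level ≤-refl) ∷ levels)
  , there (perfect-suc-¬Mid j) (AtMostOne-tail (AtMostOne-tail mids))
merge {j} (level {zero} _ ∷ level {suc k} v≤2^j ∷ levels , mids) _ v≤rest =
  suc j , promote merged-level
    (All.zipWith (uncurry Level-full⇒perfect)
      (levels , above-head⇒rest-≥2^[1+j] (AtMostOne-tail mids)
                  (2^j<leaves-gfbTree j (s≤s z≤n) v≤2^j) v≤rest))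
  where
  merged-level : Level (suc j) (node (gfbTree j 0) (gfbTree j (suc k)))
  merged-level = subst (Level (suc j))
    (trans (gfbTree-lower j v≤2^j) (cong (λ t → node t (gfbTree j (suc k))) (sym (gfbTree-zero j))))
    (level (≤-trans v≤2^j (^-monoʳ-≤ 2 (n≤1+n j))))
merge {j} (level {suc k} u≤2^j ∷ v-level ∷ levels , mids) u≤v∷rest _
  with All.zipWith (uncurry Level-full⇒perfect)
         (v-level ∷ levels , above-head⇒rest-≥2^[1+j] mids
                               (2^j<leaves-gfbTree j (s≤s z≤n) u≤2^j) u≤v∷rest)
... | refl ∷ rest-perfect = suc j , promote merged-level rest-perfect
  where
  merged-level : Level (suc j) (node (gfbTree j (suc k)) (perfect (suc j)))
  merged-level = subst (Level (suc j)) (gfbTree-upper j (s≤s z≤n))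
    (level (subst (2 ^ j + suc k ≤_) (sym (2^[1+i]≡2^i+2^i j)) (+-monoʳ-≤ (2 ^ j) u≤2^j)))

run-level : ∀ {j F T} → GFBForest j F → GFBRun F T → ∃ λ j′ → Level j′ T
run-level (t-level ∷ [] , _) (done t) = _ , t-level
run-level (levels , mids) (step u v F↭ u≤ v≤ run)
  with merge (All-resp-↭ F↭ levels , AtMostOne-resp-↭ F↭ mids) u≤ v≤
... | _ , forest = run-level forest run

run-leaves : ∀ {F T} → GFBRun F T → leaves T ≡ sum (map leaves F)
run-leaves (done t) = sym (+-identityʳ (leaves t))
run-leaves (step u v F↭ _ _ run) =
  trans (run-leaves run)
        (trans (+-assoc (leaves u) (leaves v) _) (sym (sum-↭ (map⁺ leaves F↭))))

IsGFB-level : ∀ {N T} → IsGFB N T → ∃ λ j → Level j T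
IsGFB-level {N} =
  run-level (replicate⁺ N (perfect-level 0) , All∁⇒AtMostOne (replicate⁺ N (perfect-¬Mid 0)))

IsGFB-leaves : ∀ {N T} → IsGFB N T → leaves T ≡ N
IsGFB-leaves {N} g = trans (run-leaves g) (sum-leaves-replicate N)
  where
  sum-leaves-replicate : ∀ N → sum (map leaves (replicate N leaf)) ≡ N
  sum-leaves-replicate zero    = refl
  sum-leaves-replicate (suc N) = cong suc (sum-leaves-replicate N)

IsGFB⇒gfbTree : ∀ {N T} j {r} → IsGFB N T → r ≤ 2 ^ j → N ≡ 2 ^ j + r → T ≡ gfbTree j r
IsGFB⇒gfbTree j g r≤ N≡ with IsGFB-level g | IsGFB-leaves g
... | j′ , level r′≤ | leaves≡N =
  gfbTree-determined {j′} {j} (trans (sym (leaves-gfbTree j′ r′≤)) (trans leaves≡N N≡)) r′≤ r≤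

odd-split : ∀ {n k j r} → 3 ≤ n → n ≡ suc (2 * k) → r ≤ 2 ^ j → n ≡ 2 ^ j + r →
            ∃₂ λ i s → j ≡ suc i × r ≡ suc s × suc s < 2 ^ suc i
odd-split {j = zero} 3≤n _ r≤1 refl = contradiction (≤-trans 3≤n (s≤s r≤1)) λ { (s≤s (s≤s ())) }
odd-split {k = k} {j = suc i} {zero} _ n-odd _ refl =
  contradiction (trans (sym (+-identityʳ (2 ^ suc i))) n-odd) (even≢odd (2 ^ i) k)
odd-split {k = k} {j = suc i} {suc s} _ n-odd s<2^[1+i] refl =
  i , s , refl , refl , ≤∧≢⇒< s<2^[1+i] (λ r≡ → even≢odd (2 ^ suc i) k (begin
    2 * 2 ^ suc i           ≡⟨ cong (2 ^ suc i +_) (+-identityʳ (2 ^ suc i)) ⟩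
    2 ^ suc i + 2 ^ suc i   ≡⟨ cong (2 ^ suc i +_) (sym r≡) ⟩
    2 ^ suc i + suc s       ≡⟨ n-odd ⟩
    suc (2 * k)             ∎))
  where open ≡-Reasoning

lemma9 : ∀ (n : ℕ) → 3 ≤ n → (∃ λ k → n ≡ suc (2 * k)) →
         ∀ (T T₋ T₊ : Tree) →
         IsGFB n T → IsGFB (n ∸ 1) T₋ → IsGFB (suc n) T₊ →
         CommonPending T T₋ × CommonPending T T₊
lemma9 n 3≤n (k , n-odd) T T₋ T₊ g g₋ g₊ with IsGFB-level g | IsGFB-leaves g
... | j , level {r} r≤ | leaves≡n
  with odd-split {k = k} {j = j} 3≤n n-odd r≤ (trans (sym leaves≡n) (leaves-gfbTree j r≤))
... | i , s , refl , refl , s<2^[1+i] =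
    subst (CommonPending _) (sym T₋≡) (gfbTree-adjacent i s)
  , subst (CommonPending _) (sym T₊≡) (CommonPending-sym (gfbTree-adjacent i (suc s)))
  where
  n≡ : n ≡ 2 ^ suc i + suc s
  n≡ = trans (sym leaves≡n) (leaves-gfbTree (suc i) r≤)
  n∸1≡ : n ∸ 1 ≡ 2 ^ suc i + s
  n∸1≡ = cong (_∸ 1) (trans n≡ (+-suc (2 ^ suc i) s))
  1+n≡ : suc n ≡ 2 ^ suc i + suc (suc s)
  1+n≡ = trans (cong suc n≡) (sym (+-suc (2 ^ suc i) (suc s)))
  T₋≡ : T₋ ≡ gfbTree (suc i) s
  T₋≡ = IsGFB⇒gfbTree (suc i) g₋ (≤-trans (n≤1+n s) r≤) n∸1≡
  T₊≡ : T₊ ≡ gfbTree (suc i) (suc (suc s))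
  T₊≡ = IsGFB⇒gfbTree (suc i) g₊ s<2^[1+i] 1+n≡
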